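{- There is an absolute constant $c$ such that for every $\mathrm{GT}_\le$ instance $\mathcal I$ (with parameters $\chi,n$), the graph $G_{\mathcal I}$ constructed below has pathwidth at most $c\chi$.
   Context: Pathwidth: a path decomposition of a graph $(V,E)$ is a sequence of bags $X_1,\dots,X_t\subseteq V$ covering $V$, such that every edge lies in some bag and $X_i\cap X_k\subseteq X_j$ for all $i\le j\le k$; its width is $\max_i|X_i|-1$, and the pathwidth is the minimum width over all path decompositions. Grid Tiling with Inequality ($\mathrm{GT}_\le$): an instance $\mathcal I$ consists of integers $\chi,n$ and sets $S_{i,j}\subseteq[n]^2$ for $(i,j)\in[\chi]^2$. Standing assumption: for every $(i,j)$ and every $b\in[n]$ there is $a\in[n]$ with $(a,b)\in S_{i,j}$. Pairs are ordered lexicographically: $(a,b)\le(a',b')$ iff $a<a'$, or $a=a'$ and $b\le b'$. $\boxplus$ denotes addition modulo 4 on $\{1,2,3,4\}$ (so $4\boxplus1=1$). Construction of the edge-weighted graph $G_{\mathcal I}$. For each $(i,j)\in[\chi]^2$ there is a gadget $G_{i,j}$ (in what follows the subscript $i,j$ is suppressed inside a gadget): a cycle $O_{i,j}$ through four vertices $z^1,z^2,z^3,z^4$ in this cyclic order, where the segment $O^h$ from $z^h$ to $z^{h\boxplus1}$ is a path of total length $2^{n+2}+1/n$. For each $(a,b)\in S_{i,j}$ and $h\in[4]$, the path $O^h$ contains a vertex $v^h_{(a,b)}$ at distance $d_{(a,b)}=2^b-1+a/n$ from $z^h$, and vertices $\psi^h_{(a,b)},\psi'^h_{(a,b)}$ at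 distance $2^{n+1}$ and $2^{n+1}+1/n$ from $v^h_{(a,b)}$ towards $z^{h\boxplus1}$; $O^h$ is the path through all these points in order of their distance from $z^h$, each edge having length equal to the difference of positions. A central vertex $y$ is joined to each $z^h$ by an edge of length $2^{n+1}+1$. There are four further vertices $x^1,\dots,x^4$. Let $(a^*,b^*)=\min S_{i,j}$ (lexicographic). Add edge $\{x^2,v^2_{(a^*,b^*)}\}$ of length $2^n+2^{b^*}+a^*/n$ and edge $\{x^4,v^4_{(a^*,b^*)}\}$ of length $2^{n+1}+1-2^{b^*}-a^*/n$. For $h\in\{1,3\}$ add a path $U^h=u^h_1u^h_2\cdots u^h_n$ with edge $\{u^h_\lambda,u^h_{\lambda+1}\}$ of length $2^\lambda$, and an edge $\{u^h_n,x^h\}$ of length $2^n$. For $b\in[n]$: the $b$-portal $\rho^1_b$ is $v^1_{(\alpha,b)}$ with $\alpha$ the largest value such that $(\alpha,b)\in S_{i,j}$, joined to $u^1_b$ by a portal edge of length $2^b-\alpha/n$; the $b$-portal $\rho^3_b$ is $v^3_{(\alpha,b)}$ with $\alpha$ the smallest value such that $(\alpha,b)\in S_{i,j}$, joined to $u^3_b$ by a portal edge of length $2^b-1+\alpha/n$. Gadgets are connected as follows: for $i\in[\chi-1]$, $j\in[\chi]$, a path $P_{i,j}$ from $x^3_{i,j}$ to $x^1_{i+1,j}$ consisting of $n+1$ edges of length $1/(n+1)$; for $i\in[\chi]$, $j\in[\chi-1]$, a path $P'_{i,j}=w_1\cdots w_n$ with $w_1=x^4_{i,j+1}$, $w_n=x^2_{i,j}$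 and edge $\{w_\lambda,w_{\lambda+1}\}$ of length $2^\lambda$. -}

module Defs where

open import Data.Nat using (ℕ; zero; suc; _+_; _*_; _∸_; _^_; _≤_; _<_; _≡ᵇ_; _<ᵇ_)
open import Data.Bool using (Bool; true; false; if_then_else_; _∧_)
open import Data.Fin as Fin using (Fin)
open import Data.List using (List; length)
open import Data.List.Membership.Propositional using (_∈_)
open import Data.List.Relation.Unary.Unique.Propositional using (Unique)
open import Data.Product using (Σ; ∃; _×_; _,_)
open import Data.Sum using (_⊎_)
open import Relation.Nullary using (¬_)
open import Relation.Binary.PropositionalEquality using (_≡_)

-- A bag is a duplicate-free list of vertices, so its length is its
-- cardinality.

record PathDecomposition {V : Set} (IsV : V → Set) (E : V → V → Set) : Set where
  field
    t       : ℕ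
    bag     : Fin t → List V
    unique  : ∀ k → Unique (bag k)
    sub     : ∀ k v → v ∈ bag k → IsV v
    cover   : ∀ v → IsV v → ∃ λ k → v ∈ bag k
    edge    : ∀ u v → E u v → ∃ λ k → u ∈ bag k × v ∈ bag k
    interp  : ∀ (k₁ k₂ k₃ : Fin t) → k₁ Fin.≤ k₂ → k₂ Fin.≤ k₃ →
              ∀ v → v ∈ bag k₁ → v ∈ bag k₃ → v ∈ bag k₂

PathwidthAtMost : {V : Set} (IsV : V → Set) (E : V → V → Set) → ℕ → Set
PathwidthAtMost IsV E w =
  Σ (PathDecomposition IsV E) λ D →
    ∀ k → length (PathDecomposition.bag D k) ≤ suc w

-- [m] = {1,…,m}

Rng : ℕ → ℕ → Set
Rng k m = 1 ≤ k × k ≤ m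

-- Grid Tiling with Inequality instances (1-based indices).
-- S i j a b ≡ true  means  (a,b) ∈ S_{i,j}; values outside the index
-- ranges are irrelevant.

record GTInstance : Set where
  field
    χ n      : ℕ
    n≥1      : 1 ≤ n
    S        : ℕ → ℕ → ℕ → ℕ → Bool
    S⊆[n]²   : ∀ i j a b → Rng i χ → Rng j χ → S i j a b ≡ true → Rng a n × Rng b n
    standing : ∀ i j → Rng i χ → Rng j χ → ∀ b → Rng b n →
               ∃ λ a → S i j a b ≡ true

next : ℕ → ℕ
next 4 = 1
next h = suc h

module Construction (I : GTInstance) where
  open GTInstance I

  Grid : ℕ → ℕ → Set
  Grid i j = Rng i χ × Rng j χ

  Mem : ℕ → ℕ → ℕ → ℕ → Set
  Mem i j a b = S i j a b ≡ true

  LexLe : ℕ → ℕ → ℕ → ℕ → Set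
  LexLe a b a' b' = a < a' ⊎ (a ≡ a' × b ≤ b')

  IsMinS : ℕ → ℕ → ℕ → ℕ → Set
  IsMinS i j a b = Mem i j a b × (∀ a' b' → Mem i j a' b' → LexLe a b a' b')

  -- Positions on a segment O^h, measured from z^h and multiplied by n
  -- (so they are natural numbers; the order of points is unchanged).
  dpos : ℕ → ℕ → ℕ            -- n · d_(a,b) = n(2^b − 1) + a
  dpos a b = n * (2 ^ b ∸ 1) + a

  ψpos : ℕ → ℕ → ℕ            -- n · (d_(a,b) + 2^(n+1))
  ψpos a b = dpos a b + n * 2 ^ (n + 1)

  ψ'pos : ℕ → ℕ → ℕ           -- n · (d_(a,b) + 2^(n+1) + 1/n)
  ψ'pos a b = ψpos a b + 1

  L : ℕ                       -- n · (2^(n+2) + 1/n)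
  L = n * 2 ^ (n + 2) + 1

  -- interior points of O^h (the same set of positions for every h)
  InteriorPt : ℕ → ℕ → ℕ → Set
  InteriorPt i j q = ∃ λ a → ∃ λ b → Mem i j a b ×
                       (q ≡ dpos a b ⊎ q ≡ ψpos a b ⊎ q ≡ ψ'pos a b)

  -- all points of O^h (including the endpoints z^h, z^(h⊞1))
  Pt : ℕ → ℕ → ℕ → Set
  Pt i j q = q ≡ 0 ⊎ q ≡ L ⊎ InteriorPt i j q

  data Raw : Set where
    y : (i j : ℕ) → Raw
    z : (i j h : ℕ) → Raw
    o : (i j h q : ℕ) → Raw       -- interior point of O^h_{i,j} at position q
    x : (i j h : ℕ) → Raw
    u : (i j h λ′ : ℕ) → Raw      -- u^h_λ of gadget (i,j), h ∈ {1,3}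
    p : (i j k : ℕ) → Raw         -- k-th internal vertex of P_{i,j}
    w : (i j λ′ : ℕ) → Raw        -- internal vertex w_λ of P'_{i,j}

  segV : ℕ → ℕ → ℕ → ℕ → Raw
  segV i j h q = if q ≡ᵇ 0 then z i j h else
                 if q ≡ᵇ L then z i j (next h) else o i j h q

  -- canonical name of x^h_{i,j}: when n = 1 the path P'_{i,j} = w_1
  -- forces x^4_{i,j+1} = w_1 = w_n = x^2_{i,j}.
  xv : ℕ → ℕ → ℕ → Raw
  xv i j 2 = if (n ≡ᵇ 1) ∧ (suc j <ᵇ suc χ)
             then x i (suc j) 4 else x i j 2
  xv i j h = x i j h

  pathP : ℕ → ℕ → ℕ → Raw
  pathP i j k = if k ≡ᵇ 0 then xv i j 3 else
                if k ≡ᵇ suc n then xv (suc i) j 1 else p i j k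

  pathP' : ℕ → ℕ → ℕ → Raw
  pathP' i j λ′ = if λ′ ≡ᵇ 1 then xv i (suc j) 4 else
                  if λ′ ≡ᵇ n then xv i j 2 else w i j λ′

  IsVertex : Raw → Set
  IsVertex (y i j)       = Grid i j
  IsVertex (z i j h)     = Grid i j × Rng h 4
  IsVertex (o i j h q)   = Grid i j × Rng h 4 × InteriorPt i j q
  IsVertex (x i j h)     = Grid i j × Rng h 4 × xv i j h ≡ x i j h
  IsVertex (u i j h λ′)  = Grid i j × (h ≡ 1 ⊎ h ≡ 3) × Rng λ′ n
  IsVertex (p i j k)     = (1 ≤ i × i < χ) × Rng j χ × Rng k n
  IsVertex (w i j λ′)    = Rng i χ × (1 ≤ j × j < χ) × (2 ≤ λ′ × λ′ < n)

  -- edges (each listed once, in one orientation)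
  data Edge : Raw → Raw → Set where
    yz      : ∀ {i j h} → Grid i j → Rng h 4 → Edge (y i j) (z i j h)
    seg     : ∀ {i j h q r} → Grid i j → Rng h 4 → Pt i j q → Pt i j r → q < r →
              (∀ s → q < s → s < r → ¬ Pt i j s) →
              Edge (segV i j h q) (segV i j h r)
    x2v     : ∀ {i j a b} → Grid i j → IsMinS i j a b →
              Edge (xv i j 2) (o i j 2 (dpos a b))
    x4v     : ∀ {i j a b} → Grid i j → IsMinS i j a b →
              Edge (xv i j 4) (o i j 4 (dpos a b))
    uu      : ∀ {i j h λ′} → Grid i j → (h ≡ 1 ⊎ h ≡ 3) → 1 ≤ λ′ → suc λ′ ≤ n →
              Edge (u i j h λ′) (u i j h (suc λ′))
    ux      : ∀ {i j h} → Grid i j → (h ≡ 1 ⊎ h ≡ 3) →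
              Edge (u i j h n) (xv i j h)
    portal1 : ∀ {i j b α} → Grid i j → Rng b n → Mem i j α b →
              (∀ a → Mem i j a b → a ≤ α) →
              Edge (u i j 1 b) (o i j 1 (dpos α b))
    portal3 : ∀ {i j b α} → Grid i j → Rng b n → Mem i j α b →
              (∀ a → Mem i j a b → α ≤ a) →
              Edge (u i j 3 b) (o i j 3 (dpos α b))
    pP      : ∀ {i j k} → 1 ≤ i → i < χ → Rng j χ → k ≤ n →
              Edge (pathP i j k) (pathP i j (suc k))
    pP'     : ∀ {i j λ′} → Rng i χ → 1 ≤ j → j < χ → 1 ≤ λ′ → λ′ < n →
              Edge (pathP' i j λ′) (pathP' i j (suc λ′))

-- Sweep the gadgets G_{i,j} one after another, column by column,
-- and run eight stages inside each gadget: an idle stage, one stage for each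
-- segment O^1 … O^4 (ticking through the positions on the segment), and one
-- stage each for the paths P_{i,j} and P'_{i,j}.  Every vertex is *active*
-- during a convex window of this clock: the centre y and the corners z^h for
-- the whole gadget; the attachment x^h_{i,j} from gadget (i, j−1) to gadget
-- (i, j+1); a point of O^h from the moment the sweep reaches it until it
-- reaches the next point; u^h_λ while the sweep runs through band λ of the
-- positions; and a path vertex for two consecutive ticks.  Both ends of each
-- edge are active at a common time, and at any time only 13 vertices of the
-- current gadget and 12χ attachments (three columns) can be active.
module Submission where

open import Defs
open import Data.Bool using (true; false; if_then_else_; T)
import Data.Bool as Bool
open import Data.Fin using (toℕ; fromℕ<)
open import Data.Fin.Properties using (toℕ-fromℕ<)
open import Data.List using (List; []; _∷_; _++_; length; filter; deduplicate)
open import Data.List.Properties using (≡-dec; length-filter; length-deduplicate; length-++)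
open import Data.List.Membership.Propositional using (_∈_)
open import Data.List.Membership.Propositional.Properties
  using (∈-++⁺ˡ; ∈-++⁺ʳ; ∈-filter⁺; ∈-filter⁻; ∈-deduplicate⁺)
open import Data.List.Relation.Unary.Any using (here; there)
import Data.List.Relation.Unary.Unique.DecPropositional.Properties as UniqueDec
open import Data.Nat
open import Data.Nat.Properties
open import Data.Nat.DivMod
open import Data.Nat.Divisibility using (n∣m*n)
open import Data.Product
open import Data.Sum using (_⊎_; inj₁; inj₂)
open import Data.Unit using (tt)
open import Function.Base using (_∘_)
open import Function.Bundles using (mk↣)
open import Relation.Nullary using (Dec; yes; no; ¬_; contradiction)
open import Relation.Nullary.Decidable using (_×-dec_; _⊎-dec_; map′; via-injection; from-yes)
open import Relation.Unary using (Decidable)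
open import Relation.Binary.Definitions using (DecidableEquality)
open import Relation.Binary.PropositionalEquality

-- A schedule lets every vertex be "active" during a window of consecutive
-- times; listing the active vertices at each time gives a path decomposition.
record Schedule {V : Set} (IsV : V → Set) (E : V → V → Set) : Set₁ where
  field
    horizon    : ℕ
    Active     : ℕ → V → Set
    active?    : ∀ k v → Dec (Active k v)
    candidates : ℕ → List V
    listed     : ∀ k v → IsV v → Active k v → v ∈ candidates k
    convex     : ∀ v → IsV v → ∀ {k₁ k₂ k₃} → k₁ ≤ k₂ → k₂ ≤ k₃ →
                 Active k₁ v → Active k₃ v → Active k₂ v
    covered    : ∀ v → IsV v → ∃ λ k → k < horizon × Active k v
    edgeMet    : ∀ u v → E u v → ∃ λ k → k < horizon ×
                 (IsV u × Active k u) × (IsV v × Active k v)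

length-≤-if-inhabited : ∀ {A : Set} (xs : List A) {c} →
                        (∀ {v} → v ∈ xs → length xs ≤ c) → length xs ≤ c
length-≤-if-inhabited []      _     = z≤n
length-≤-if-inhabited (v ∷ _) bound = bound (here refl)

-- The bag at time k consists of the (distinct) vertices active at k; its
-- width is controlled by the candidate lists of graphs that have a vertex.
schedule⇒pathwidth : ∀ {V : Set} {IsV : V → Set} {E : V → V → Set} →
  DecidableEquality V → (∀ v → Dec (IsV v)) → (S : Schedule IsV E) → ∀ w →
  (∀ k v → IsV v → length (Schedule.candidates S k) ≤ suc w) →
  PathwidthAtMost IsV E w
schedule⇒pathwidth {V} {IsV} {E} _≟_ isV? S w short = decomposition , bag-short
  where
  open Schedule S

  Occupies : ℕ → V → Set
  Occupies k v = IsV v × Active k v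

  bagAt : ℕ → List V
  bagAt k = filter (λ v → isV? v ×-dec active? k v) (deduplicate _≟_ (candidates k))

  bagAt⁺ : ∀ k {v} → Occupies k v → v ∈ bagAt k
  bagAt⁺ k {v} (isV , act) = ∈-filter⁺ _ (∈-deduplicate⁺ _≟_ (listed k v isV act)) (isV , act)

  bagAt⁻ : ∀ k {v} → v ∈ bagAt k → Occupies k v
  bagAt⁻ k v∈ = proj₂ (∈-filter⁻ _ {xs = deduplicate _≟_ (candidates k)} v∈)

  bagAt-fromℕ< : ∀ {k v} (k<h : k < horizon) → Occupies k v → v ∈ bagAt (toℕ (fromℕ< k<h))
  bagAt-fromℕ< k<h occ rewrite toℕ-fromℕ< k<h = bagAt⁺ _ occ

  decomposition : PathDecomposition IsV E
  decomposition = record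
    { t      = horizon
    ; bag    = λ k → bagAt (toℕ k)
    ; unique = λ k → UniqueDec.filter⁺ _ (UniqueDec.deduplicate-! _≟_ (candidates (toℕ k)))
    ; sub    = λ k v v∈ → proj₁ (bagAt⁻ (toℕ k) v∈)
    ; cover  = λ v isV → let k , k<h , act = covered v isV in
                          fromℕ< k<h , bagAt-fromℕ< k<h (isV , act)
    ; edge   = λ u v uv → let k , k<h , occ-u , occ-v = edgeMet u v uv in
                          fromℕ< k<h , bagAt-fromℕ< k<h occ-u , bagAt-fromℕ< k<h occ-v
    ; interp = λ k₁ k₂ k₃ k₁≤k₂ k₂≤k₃ v v∈₁ v∈₃ →
        let isV , act₁ = bagAt⁻ (toℕ k₁) v∈₁ in
        bagAt⁺ (toℕ k₂) (isV , convex v isV k₁≤k₂ k₂≤k₃ act₁ (proj₂ (bagAt⁻ (toℕ k₃) v∈₃)))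
    }

  bag-short : ∀ k → length (PathDecomposition.bag decomposition k) ≤ suc w
  bag-short k = length-≤-if-inhabited (bagAt (toℕ k)) λ {v} v∈ →
    ≤-trans (length-filter _ (deduplicate _≟_ (candidates (toℕ k))))
      (≤-trans (length-deduplicate _≟_ (candidates (toℕ k)))
        (short (toℕ k) v (proj₁ (bagAt⁻ (toℕ k) v∈))))

module _ {d : ℕ} .{{_ : NonZero d}} where

  digit-% : ∀ {r} q → r < d → (r + q * d) % d ≡ r
  digit-% {r} q r<d = trans ([m+kn]%n≡m%n r q d) (m<n⇒m%n≡m r<d)

  digit-/ : ∀ {r} q → r < d → (r + q * d) / d ≡ q
  digit-/ {r} q r<d = begin
    (r + q * d) / d     ≡⟨ +-distrib-/-∣ʳ r (n∣m*n q) ⟩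
    r / d + q * d / d   ≡⟨ cong₂ _+_ (m<n⇒m/n≡0 r<d) (m*n/n≡m q d) ⟩
    q                   ∎
    where open ≡-Reasoning

  %-mono-same-/ : ∀ {k₁ k₂} → k₁ ≤ k₂ → k₁ / d ≡ k₂ / d → k₁ % d ≤ k₂ % d
  %-mono-same-/ {k₁} {k₂} k₁≤k₂ same = +-cancelʳ-≤ (k₂ / d * d) _ _
    (subst (λ e → k₁ % d + e * d ≤ k₂ % d + k₂ / d * d) same
      (subst₂ _≤_ (m≡m%n+[m/n]*n k₁ d) (m≡m%n+[m/n]*n k₂ d) k₁≤k₂))

  same-quotient : ∀ {k₁ k₂ k₃} → k₁ ≤ k₂ → k₂ ≤ k₃ → k₁ / d ≡ k₃ / d →
                  k₂ / d ≡ k₁ / d × k₁ % d ≤ k₂ % d × k₂ % d ≤ k₃ % d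
  same-quotient {k₁} {k₂} {k₃} k₁≤k₂ k₂≤k₃ same = q₂≡q₁ , %-mono-same-/ k₁≤k₂ (sym q₂≡q₁)
    , %-mono-same-/ k₂≤k₃ (trans q₂≡q₁ same)
    where
    q₂≡q₁ : k₂ / d ≡ k₁ / d
    q₂≡q₁ = ≤-antisym (≤-trans (/-monoˡ-≤ d k₂≤k₃) (≤-reflexive (sym same))) (/-monoˡ-≤ d k₁≤k₂)

successive : ∀ {m l} → m ≤ l → l ≤ suc m → l ≡ m ⊎ l ≡ suc m
successive m≤l l≤1+m with m≤n⇒m<n∨m≡n l≤1+m
... | inj₁ l<1+m = inj₁ (≤-antisym (s≤s⁻¹ l<1+m) m≤l)
... | inj₂ l≡1+m = inj₂ l≡1+m

predecessor-choice : ∀ {m l} → l ≡ m ⊎ l ≡ suc m → m ≡ l ⊎ m ≡ l ∸ 1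
predecessor-choice (inj₁ refl) = inj₁ refl
predecessor-choice (inj₂ refl) = inj₂ refl

Convex : (ℕ → Set) → Set
Convex P = ∀ {a b c} → a ≤ b → b ≤ c → P a → P c → P b

-- The last number below m satisfying a decidable predicate (0 if none).
module _ {P : ℕ → Set} (P? : Decidable P) where

  lastBelow : ℕ → ℕ
  lastBelow zero = 0
  lastBelow (suc m) with P? m
  ... | yes _ = m
  ... | no  _ = lastBelow m

  lastBelow-≤ : ∀ m → lastBelow m ≤ m
  lastBelow-≤ zero = z≤n
  lastBelow-≤ (suc m) with P? m
  ... | yes _ = n≤1+n m
  ... | no  _ = m≤n⇒m≤1+n (lastBelow-≤ m)

  lastBelow-maximal : ∀ {q} m → P q → q < m → q ≤ lastBelow m
  lastBelow-maximal (suc m) Pq q<1+m with P? m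
  ... | yes _ = s≤s⁻¹ q<1+m
  ... | no ¬Pm with m≤n⇒m<n∨m≡n (s≤s⁻¹ q<1+m)
  ...   | inj₁ q<m  = lastBelow-maximal m Pq q<m
  ...   | inj₂ refl = contradiction Pq ¬Pm

  lastBelow-found : ∀ m → lastBelow m ≡ 0 ⊎ (P (lastBelow m) × lastBelow m < m)
  lastBelow-found zero = inj₁ refl
  lastBelow-found (suc m) with P? m
  ... | yes Pm = inj₂ (Pm , ≤-refl)
  ... | no  _ with lastBelow-found m
  ...   | inj₁ l≡0        = inj₁ l≡0
  ...   | inj₂ (Pl , l<m) = inj₂ (Pl , m<n⇒m<1+n l<m)

  lastBelow-mono : ∀ {m m′} → m ≤ m′ → lastBelow m ≤ lastBelow m′
  lastBelow-mono {m} m≤m′ with lastBelow-found m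
  ... | inj₁ l≡0        = subst (_≤ _) (sym l≡0) z≤n
  ... | inj₂ (Pl , l<m) = lastBelow-maximal _ Pl (<-≤-trans l<m m≤m′)

  lastBelow-gap : ∀ {q r} → P q → q < r → (∀ s → q < s → s < r → ¬ P s) →
                  lastBelow r ≡ q
  lastBelow-gap {q} {r} Pq q<r gap = ≤-antisym last≤q (lastBelow-maximal r Pq q<r)
    where
    last≤q : lastBelow r ≤ q
    last≤q with lastBelow-found r
    ... | inj₁ l≡0        = subst (_≤ q) (sym l≡0) z≤n
    ... | inj₂ (Pl , l<r) = ≮⇒≥ (λ q<l → gap _ q<l l<r Pl)

  -- A sweep over positions l "touches" q when q is l itself or the last point
  -- strictly before l; for a point q this happens during an interval of l.
  Swept : ℕ → ℕ → Set
  Swept q l = q ≡ l ⊎ q ≡ lastBelow l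

  swept-convex : ∀ {q} → P q → Convex (Swept q)
  swept-convex {q} Pq {l₁} {l₂} {l₃} l₁≤l₂ l₂≤l₃ sw₁ sw₃ with q ≟ l₂
  ... | yes q≡l₂ = inj₁ q≡l₂
  ... | no  q≢l₂ = inj₂ (≤-antisym (lower sw₁) (upper sw₃))
    where
    lower : Swept q l₁ → q ≤ lastBelow l₂
    lower (inj₁ refl) = lastBelow-maximal l₂ Pq (≤∧≢⇒< l₁≤l₂ q≢l₂)
    lower (inj₂ refl) = lastBelow-mono l₁≤l₂
    upper : Swept q l₃ → lastBelow l₂ ≤ q
    upper (inj₁ refl) = ≤-trans (lastBelow-≤ l₂) l₂≤l₃
    upper (inj₂ refl) = lastBelow-mono l₂≤l₃

step⇒strict : ∀ {f : ℕ → ℕ} → (∀ a → f a < f (suc a)) → ∀ {a c} → a < c → f a < f c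
step⇒strict step {a} {suc c} a<1+c with m≤n⇒m<n∨m≡n (s≤s⁻¹ a<1+c)
... | inj₁ a<c  = <-trans (step⇒strict step a<c) (step c)
... | inj₂ refl = step a

step⇒≥id : ∀ {f : ℕ → ℕ} → (∀ a → f a < f (suc a)) → ∀ b → b ≤ f b
step⇒≥id step zero    = z≤n
step⇒≥id step (suc b) = <-≤-trans (s≤s (step⇒≥id step b)) (step b)

lastBelow-window : ∀ {f : ℕ → ℕ} → (∀ {a c} → a < c → f a < f c) →
                   ∀ {b l} m → b < m → f b ≤ l → l ≤ f (suc b) →
                   let c = lastBelow (λ c → f c ≤? l) m in c ≡ b ⊎ c ≡ suc b
lastBelow-window {f} f-strict {b} {l} m b<m fb≤l l≤f1+b =
  successive (lastBelow-maximal _ m fb≤l b<m) (≮⇒≥ c≮)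
  where
  c≮ : ¬ (suc b < lastBelow (λ c → f c ≤? l) m)
  c≮ 1+b<c with lastBelow-found (λ c → f c ≤? l) m
  ... | inj₁ c≡0         = contradiction (subst (suc b <_) c≡0 1+b<c) λ ()
  ... | inj₂ (fc≤l , _) = <-irrefl refl (<-≤-trans (f-strict 1+b<c) (≤-trans fc≤l l≤f1+b))

≡ᵇ-true : ∀ {m m′} → (m ≡ᵇ m′) ≡ true → m ≡ m′
≡ᵇ-true {m} {m′} e = ≡ᵇ⇒≡ m m′ (subst T (sym e) tt)

≡ᵇ-false : ∀ {m m′} → (m ≡ᵇ m′) ≡ false → m ≢ m′
≡ᵇ-false {m} {m′} e m≡m′ = subst T e (≡⇒≡ᵇ m m′ m≡m′)

if²-≡ᵇ : ∀ {A : Set} m m₁ m₂ {a b c : A} →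
         let v = if m ≡ᵇ m₁ then a else if m ≡ᵇ m₂ then b else c in
         (m ≡ m₁ × v ≡ a) ⊎ (m ≢ m₁ × m ≡ m₂ × v ≡ b) ⊎ (m ≢ m₁ × m ≢ m₂ × v ≡ c)
if²-≡ᵇ m m₁ m₂ with m ≡ᵇ m₁ in e₁ | m ≡ᵇ m₂ in e₂
... | true  | _     = inj₁ (≡ᵇ-true e₁ , refl)
... | false | true  = inj₂ (inj₁ (≡ᵇ-false e₁ , ≡ᵇ-true e₂ , refl))
... | false | false = inj₂ (inj₂ (≡ᵇ-false e₁ , ≡ᵇ-false e₂ , refl))

fourOf : ∀ {A : Set} → (ℕ → A) → List A
fourOf v = v 1 ∷ v 2 ∷ v 3 ∷ v 4 ∷ []

∈-fourOf : ∀ {A : Set} (v : ℕ → A) {h} → Rng h 4 → v h ∈ fourOf v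
∈-fourOf v {1} _ = here refl
∈-fourOf v {2} _ = there (here refl)
∈-fourOf v {3} _ = there (there (here refl))
∈-fourOf v {4} _ = there (there (there (here refl)))
∈-fourOf v {suc (suc (suc (suc (suc _))))} (_ , s≤s (s≤s (s≤s (s≤s ()))))

concatRange : ∀ {A : Set} → (ℕ → List A) → ℕ → List A
concatRange F zero    = []
concatRange F (suc m) = F (suc m) ++ concatRange F m

∈-concatRange : ∀ {A : Set} (F : ℕ → List A) {v i} m → Rng i m → v ∈ F i → v ∈ concatRange F m
∈-concatRange F zero    (1≤i , i≤0) v∈ = contradiction (≤-trans 1≤i i≤0) λ ()
∈-concatRange F (suc m) (1≤i , i≤1+m) v∈ with m≤n⇒m<n∨m≡n i≤1+m
... | inj₂ refl = ∈-++⁺ˡ v∈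
... | inj₁ i<1+m = ∈-++⁺ʳ (F (suc m)) (∈-concatRange F m (1≤i , s≤s⁻¹ i<1+m) v∈)

length-concatRange : ∀ {A : Set} (F : ℕ → List A) {c} → (∀ i → length (F i) ≡ c) →
                     ∀ m → length (concatRange F m) ≡ m * c
length-concatRange F same zero    = refl
length-concatRange F same (suc m) =
  trans (length-++ (F (suc m))) (cong₂ _+_ (same (suc m)) (length-concatRange F same m))

module GadgetSchedule (I : GTInstance) where
  open GTInstance I
  open Construction I

  -- Vertex names have decidable equality: they are coded injectively by lists of numbers.
  encode : Raw → List ℕ
  encode (y i j)     = 0 ∷ i ∷ j ∷ []
  encode (z i j h)   = 1 ∷ i ∷ j ∷ h ∷ []
  encode (o i j h q) = 2 ∷ i ∷ j ∷ h ∷ q ∷ []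
  encode (x i j h)   = 3 ∷ i ∷ j ∷ h ∷ []
  encode (u i j h l) = 4 ∷ i ∷ j ∷ h ∷ l ∷ []
  encode (p i j k)   = 5 ∷ i ∷ j ∷ k ∷ []
  encode (w i j l)   = 6 ∷ i ∷ j ∷ l ∷ []

  decode : List ℕ → Raw
  decode (0 ∷ i ∷ j ∷ [])         = y i j
  decode (1 ∷ i ∷ j ∷ h ∷ [])     = z i j h
  decode (2 ∷ i ∷ j ∷ h ∷ q ∷ []) = o i j h q
  decode (3 ∷ i ∷ j ∷ h ∷ [])     = x i j h
  decode (4 ∷ i ∷ j ∷ h ∷ l ∷ []) = u i j h l
  decode (5 ∷ i ∷ j ∷ k ∷ [])     = p i j k
  decode (6 ∷ i ∷ j ∷ l ∷ [])     = w i j l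
  decode _                        = y 0 0

  decode-encode : ∀ v → decode (encode v) ≡ v
  decode-encode (y _ _)       = refl
  decode-encode (z _ _ _)     = refl
  decode-encode (o _ _ _ _)   = refl
  decode-encode (x _ _ _)     = refl
  decode-encode (u _ _ _ _)   = refl
  decode-encode (p _ _ _)     = refl
  decode-encode (w _ _ _)     = refl

  _≟ᵥ_ : DecidableEquality Raw
  _≟ᵥ_ = via-injection (mk↣ encode-injective) (≡-dec _≟_)
    where
    encode-injective : ∀ {v v′} → encode v ≡ encode v′ → v ≡ v′
    encode-injective {v} {v′} e =
      trans (sym (decode-encode v)) (trans (cong decode e) (decode-encode v′))

  -- Positions on a segment (scaled by n).  The portals v_(a,b) with a ≤ n
  -- lie in the band [band b, band (1+b)], where band b = n·(2^b − 1).
  band : ℕ → ℕ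
  band b = n * (2 ^ b ∸ 1)

  n≤n*2^b : ∀ b → n ≤ n * 2 ^ b
  n≤n*2^b b = subst (_≤ n * 2 ^ b) (*-identityʳ n) (*-monoʳ-≤ n (m^n>0 2 b))

  band-step : ∀ b → band (suc b) ≡ n * 2 ^ b + band b
  band-step b = begin
    n * (2 ^ b + (2 ^ b + 0) ∸ 1)  ≡⟨ cong (λ e → n * (2 ^ b + e ∸ 1)) (+-identityʳ (2 ^ b)) ⟩
    n * (2 ^ b + 2 ^ b ∸ 1)        ≡⟨ cong (n *_) (+-∸-assoc (2 ^ b) (m^n>0 2 b)) ⟩
    n * (2 ^ b + (2 ^ b ∸ 1))      ≡⟨ *-distribˡ-+ n (2 ^ b) (2 ^ b ∸ 1) ⟩
    n * 2 ^ b + band b             ∎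
    where open ≡-Reasoning

  band-increasing : ∀ b → band b < band (suc b)
  band-increasing b = subst (band b <_) (sym (band-step b))
    (m<n+m (band b) (≤-trans n≥1 (n≤n*2^b b)))

  dpos-in-band : ∀ {a} b → a ≤ n → band b ≤ dpos a b × dpos a b ≤ band (suc b)
  dpos-in-band {a} b a≤n = m≤m+n (band b) a ,
    subst (dpos a b ≤_) (sym (band-step b))
      (subst (_≤ n * 2 ^ b + band b) (+-comm a (band b))
        (+-monoˡ-≤ (band b) (≤-trans a≤n (n≤n*2^b b))))

  level : ℕ → ℕ
  level l = lastBelow (λ b → band b ≤? l) (suc n)

  level-window : ∀ {b l} → b ≤ n → band b ≤ l → l ≤ band (suc b) →
                 level l ≡ b ⊎ level l ≡ suc b
  level-window b≤n = lastBelow-window (step⇒strict band-increasing) (suc n) (s≤s b≤n)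

  Mark : ℕ → ℕ → ℕ → Set
  Mark a b q = q ≡ dpos a b ⊎ q ≡ ψpos a b ⊎ q ≡ ψ'pos a b

  -- Deciding whether q is a point of a segment: the coordinates of an
  -- interior point q are bounded by q itself.
  PointAt : ℕ → ℕ → ℕ → ℕ → ℕ → Set
  PointAt i j q a b = Mem i j a b × Mark a b q

  dpos≤point : ∀ {q} a b → Mark a b q → dpos a b ≤ q
  dpos≤point a b (inj₁ refl)        = ≤-refl
  dpos≤point a b (inj₂ (inj₁ refl)) = m≤m+n (dpos a b) _
  dpos≤point a b (inj₂ (inj₂ refl)) = ≤-trans (m≤m+n (dpos a b) _) (m≤m+n (ψpos a b) 1)

  interior? : ∀ i j q → Dec (InteriorPt i j q)
  interior? i j q = map′ (λ (a , _ , b , _ , at) → a , b , at) bounded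
    (anyUpTo? (λ a → anyUpTo? (λ b → pointAt? a b) (suc q)) (suc q))
    where
    pointAt? : ∀ a b → Dec (PointAt i j q a b)
    pointAt? a b = (S i j a b Bool.≟ true) ×-dec
                   (q ≟ dpos a b ⊎-dec q ≟ ψpos a b ⊎-dec q ≟ ψ'pos a b)
    bounded : InteriorPt i j q → ∃ λ a → a < suc q × ∃ λ b → b < suc q × PointAt i j q a b
    bounded (a , b , mem , at) =
        a , s≤s (≤-trans (m≤n+m a (band b)) (dpos≤point a b at))
      , b , s≤s (≤-trans (step⇒≥id band-increasing b)
                   (≤-trans (m≤m+n (band b) a) (dpos≤point a b at)))
      , mem , at

  point? : ∀ i j q → Dec (Pt i j q)
  point? i j q = q ≟ 0 ⊎-dec q ≟ L ⊎-dec interior? i j q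

  prevPt : ℕ → ℕ → ℕ → ℕ
  prevPt i j = lastBelow (point? i j)

  -- Every interior point lies at position ≤ 1 + reach and every endpoint at
  -- ≤ L, so the local clock of a stage runs over 0 … M − 1.
  reach : ℕ
  reach = n * 2 ^ n + n + n * 2 ^ (n + 1)

  M : ℕ
  M = 2 + (reach + L)

  ≤reach⇒<M : ∀ {q} → q ≤ suc reach → q < M
  ≤reach⇒<M q≤ = s≤s (≤-trans q≤ (s≤s (m≤m+n reach L)))

  band≤n*2^b : ∀ b → band b ≤ n * 2 ^ b
  band≤n*2^b b = *-monoʳ-≤ n (m∸n≤m (2 ^ b) 1)

  band<M : ∀ {b} → b ≤ suc n → band b < M
  band<M {b} b≤1+n = ≤reach⇒<M (m≤n⇒m≤1+n (≤-trans (band≤n*2^b b)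
    (≤-trans (*-monoʳ-≤ n (^-monoʳ-≤ 2 (subst (b ≤_) (+-comm 1 n) b≤1+n))) (m≤n+m _ _))))

  ≤1+n⇒<M : ∀ {l} → l ≤ suc n → l < M
  ≤1+n⇒<M l≤1+n = ≤reach⇒<M (≤-trans l≤1+n (s≤s (≤-trans (m≤n+m n (n * 2 ^ n)) (m≤m+n _ (n * 2 ^ (n + 1))))))

  point≤ψ′ : ∀ {q} a b → Mark a b q → q ≤ ψ'pos a b
  point≤ψ′ a b (inj₁ refl)        = ≤-trans (m≤m+n (dpos a b) _) (m≤m+n (ψpos a b) 1)
  point≤ψ′ a b (inj₂ (inj₁ refl)) = m≤m+n (ψpos a b) 1
  point≤ψ′ a b (inj₂ (inj₂ refl)) = ≤-refl

  ψ′≤reach : ∀ {a b} → a ≤ n → b ≤ n → ψ'pos a b ≤ suc reach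
  ψ′≤reach {a} {b} a≤n b≤n = subst (ψ'pos a b ≤_) (+-comm reach 1)
    (+-monoˡ-≤ 1 (+-monoˡ-≤ (n * 2 ^ (n + 1)) (+-mono-≤ band≤ a≤n)))
    where
    band≤ : band b ≤ n * 2 ^ n
    band≤ = ≤-trans (band≤n*2^b b) (*-monoʳ-≤ n (^-monoʳ-≤ 2 b≤n))

  interior<M : ∀ {i j q} → Grid i j → InteriorPt i j q → q < M
  interior<M (i∈ , j∈) (a , b , mem , at) with S⊆[n]² _ _ a b i∈ j∈ mem
  ... | (_ , a≤n) , (_ , b≤n) = ≤reach⇒<M (≤-trans (point≤ψ′ a b at) (ψ′≤reach a≤n b≤n))

  point<M : ∀ {i j q} → Grid i j → Pt i j q → q < M
  point<M _    (inj₁ refl)         = s≤s z≤n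
  point<M _    (inj₂ (inj₁ refl))  = s≤s (≤-trans (m≤n+m L reach) (n≤1+n _))
  point<M grid (inj₂ (inj₂ inner)) = interior<M grid inner

  -- Gadgets are visited column by column (gadget i j = i + j·N);
  -- each gadget has 8 stages of M ticks: stage 0 is idle, stages 1 – 4 sweep
  -- the segments O^1 … O^4, stage 5 the path P_{i,j}, stage 6 the path P'_{i,j}.
  N : ℕ
  N = suc χ

  gadget : ℕ → ℕ → ℕ
  gadget i j = i + j * N

  stageNo : ℕ → ℕ → ℕ → ℕ
  stageNo i j h = h + gadget i j * 8

  time : ℕ → ℕ → ℕ → ℕ → ℕ
  time i j h l = l + stageNo i j h * M

  rng4<8 : ∀ {h} → Rng h 4 → h < 8
  rng4<8 (_ , h≤4) = s≤s (≤-trans h≤4 (m≤m+n 4 3))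

  odd<8 : ∀ {h} → (h ≡ 1 ⊎ h ≡ 3) → h < 8
  odd<8 (inj₁ refl) = from-yes (1 <? 8)
  odd<8 (inj₂ refl) = from-yes (3 <? 8)

  stage tick phase block row col : ℕ → ℕ
  stage k = k / M
  tick  k = k % M
  phase k = stage k % 8
  block k = stage k / 8
  row   k = block k % N
  col   k = block k / N

  stage-time : ∀ i j h {l} → l < M → stage (time i j h l) ≡ stageNo i j h
  stage-time i j h = digit-/ (stageNo i j h)

  tick-time : ∀ i j h {l} → l < M → tick (time i j h l) ≡ l
  tick-time i j h = digit-% (stageNo i j h)

  block-of-stage : ∀ k i j {h} → h < 8 → stage k ≡ stageNo i j h → block k ≡ gadget i j
  block-of-stage k i j h<8 st = trans (cong (_/ 8) st) (digit-/ (gadget i j) h<8)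

  phase-of-stage : ∀ k i j {h} → h < 8 → stage k ≡ stageNo i j h → phase k ≡ h
  phase-of-stage k i j h<8 st = trans (cong (_% 8) st) (digit-% (gadget i j) h<8)

  row-of-block : ∀ k i j → i ≤ χ → block k ≡ gadget i j → row k ≡ i
  row-of-block k i j i≤χ blk = trans (cong (_% N) blk) (digit-% j (s≤s i≤χ))

  col-of-block : ∀ k i j → i ≤ χ → block k ≡ gadget i j → col k ≡ j
  col-of-block k i j i≤χ blk = trans (cong (_/ N) blk) (digit-/ j (s≤s i≤χ))

  block-time : ∀ i j {h l} → h < 8 → l < M → block (time i j h l) ≡ gadget i j
  block-time i j {h} {l} h<8 l<M = block-of-stage (time i j h l) i j h<8 (stage-time i j h l<M)

  block-mono : ∀ {k₁ k₂} → k₁ ≤ k₂ → block k₁ ≤ block k₂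
  block-mono k₁≤k₂ = /-monoˡ-≤ 8 (/-monoˡ-≤ M k₁≤k₂)

  block-squeeze : ∀ {k₁ k₂ k₃ g} → k₁ ≤ k₂ → k₂ ≤ k₃ →
                  block k₁ ≡ g → block k₃ ≡ g → block k₂ ≡ g
  block-squeeze {k₂ = k₂} k₁≤k₂ k₂≤k₃ refl b₃ =
    ≤-antisym (subst (block k₂ ≤_) b₃ (block-mono k₂≤k₃)) (block-mono k₁≤k₂)

  gadget-monoʳ : ∀ i {j j′} → j ≤ j′ → gadget i j ≤ gadget i j′
  gadget-monoʳ i j≤j′ = +-monoʳ-≤ i (*-monoˡ-≤ N j≤j′)

  -- Gadget (i+1, j−1) comes no later than (i, j), and (i+1, j+1) no earlier:
  -- x^1_{i+1,j}, the far end of P_{i,j}, is active during the block of (i, j).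
  gadget-next-row : ∀ i {j} → 1 ≤ j → gadget (suc i) (j ∸ 1) ≤ gadget i j
  gadget-next-row i {suc j} _ = ≤-trans (+-monoˡ-≤ (j * N) (m<m+n i z<s)) (≤-reflexive (+-assoc i N (j * N)))

  gadget-diagonal : ∀ i j → gadget i j ≤ gadget (suc i) (suc j)
  gadget-diagonal i j = +-mono-≤ (n≤1+n i) (*-monoˡ-≤ N (n≤1+n j))

  horizon : ℕ
  horizon = suc (stageNo χ χ 7) * M

  time<horizon : ∀ {i j h l} → i ≤ χ → j ≤ χ → h < 8 → l < M → time i j h l < horizon
  time<horizon {i} {j} {h} {l} i≤χ j≤χ h<8 l<M =
    <-≤-trans (+-monoˡ-< (stageNo i j h * M) l<M) (*-monoˡ-≤ M (s≤s stage≤))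
    where
    stage≤ : stageNo i j h ≤ stageNo χ χ 7
    stage≤ = +-mono-≤ (s≤s⁻¹ h<8) (*-monoˡ-≤ 8 (+-mono-≤ i≤χ (*-monoˡ-≤ N j≤χ)))

  Between : ℕ → ℕ → ℕ → Set
  Between lo hi l = lo ≤ l × l ≤ hi

  During : ℕ → (ℕ → Set) → ℕ → Set
  During s P k = stage k ≡ s × P (tick k)

  between-convex : ∀ {lo hi} → Convex (Between lo hi)
  between-convex a≤b b≤c (lo≤a , _) (_ , c≤hi) = ≤-trans lo≤a a≤b , ≤-trans b≤c c≤hi

  during-convex : ∀ {s P} → Convex P → Convex (During s P)
  during-convex P-convex k₁≤k₂ k₂≤k₃ (st₁ , P₁) (st₃ , P₃)
    with same-quotient k₁≤k₂ k₂≤k₃ (trans st₁ (sym st₃))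
  ... | st₂≡st₁ , t₁≤t₂ , t₂≤t₃ = trans st₂≡st₁ st₁ , P-convex t₁≤t₂ t₂≤t₃ P₁ P₃

  -- The schedule: a vertex of gadget (i,j) is active
  --  * y, z^h: throughout the gadget's block;
  --  * x^h: from block (i, j−1) to block (i, j+1), so that the paths P, P'
  --    leaving the gadget and its neighbours can be swept;
  --  * a segment point q: in stage h, when the sweep reaches q and until it
  --    reaches the next point;
  --  * u^h_λ: in stage h while the sweep is in band λ;
  --  * the k-th vertex of P (of P'): at ticks k and k+1 of stage 5 (stage 6).
  Active : ℕ → Raw → Set
  Active k (y i j)      = block k ≡ gadget i j
  Active k (z i j _)    = block k ≡ gadget i j
  Active k (x i j _)    = gadget i (j ∸ 1) ≤ block k × block k ≤ gadget i (suc j)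
  Active k (o i j h q)  = During (stageNo i j h) (Swept (point? i j) q) k
  Active k (u i j h λ′) = During (stageNo i j h) (Between (band λ′) (band (suc λ′))) k
  Active k (p i j m)    = During (stageNo i j 5) (Between m (suc m)) k
  Active k (w i j λ′)   = During (stageNo i j 6) (Between λ′ (suc λ′)) k

  active? : ∀ k v → Dec (Active k v)
  active? k (y i j)      = block k ≟ gadget i j
  active? k (z i j _)    = block k ≟ gadget i j
  active? k (x i j _)    = gadget i (j ∸ 1) ≤? block k ×-dec block k ≤? gadget i (suc j)
  active? k (o i j h q)  = stage k ≟ stageNo i j h ×-dec
                           (q ≟ tick k ⊎-dec q ≟ prevPt i j (tick k))
  active? k (u i j h λ′) = stage k ≟ stageNo i j h ×-dec
                           (band λ′ ≤? tick k ×-dec tick k ≤? band (suc λ′))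
  active? k (p i j m)    = stage k ≟ stageNo i j 5 ×-dec (m ≤? tick k ×-dec tick k ≤? suc m)
  active? k (w i j λ′)   = stage k ≟ stageNo i j 6 ×-dec (λ′ ≤? tick k ×-dec tick k ≤? suc λ′)

  active-convex : ∀ v → IsVertex v → ∀ {k₁ k₂ k₃} → k₁ ≤ k₂ → k₂ ≤ k₃ →
                  Active k₁ v → Active k₃ v → Active k₂ v
  active-convex (y _ _)     _ k₁≤k₂ k₂≤k₃ b₁ b₃ = block-squeeze k₁≤k₂ k₂≤k₃ b₁ b₃
  active-convex (z _ _ _)   _ k₁≤k₂ k₂≤k₃ b₁ b₃ = block-squeeze k₁≤k₂ k₂≤k₃ b₁ b₃
  active-convex (x _ _ _)   _ k₁≤k₂ k₂≤k₃ (lo , _) (_ , hi) =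
    ≤-trans lo (block-mono k₁≤k₂) , ≤-trans (block-mono k₂≤k₃) hi
  active-convex (o i j _ q) (_ , _ , inner) =
    during-convex (swept-convex (point? i j) (inj₂ (inj₂ inner)))
  active-convex (u _ _ _ _) _ = during-convex between-convex
  active-convex (p _ _ _)   _ = during-convex between-convex
  active-convex (w _ _ _)   _ = during-convex between-convex

  -- Candidates at time k: the 13 vertices of the current gadget that can be
  -- active in the current stage, and the attachments x^h of three columns.
  sweepAt : ℕ → ℕ → ℕ → ℕ → List Raw
  sweepAt i j s l = o i j s l ∷ o i j s (prevPt i j l)
                  ∷ u i j s (level l) ∷ u i j s (level l ∸ 1)
                  ∷ p i j l ∷ p i j (l ∸ 1) ∷ w i j l ∷ w i j (l ∸ 1) ∷ []

  gadgetAt : ℕ → ℕ → ℕ → ℕ → List Raw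
  gadgetAt i j s l = y i j ∷ fourOf (z i j) ++ sweepAt i j s l

  xNear : ℕ → ℕ → List Raw
  xNear J i = fourOf (x i (J ∸ 1)) ++ fourOf (x i J) ++ fourOf (x i (suc J))

  candidatesFor : ℕ → ℕ → ℕ → ℕ → List Raw
  candidatesFor i j s l = gadgetAt i j s l ++ concatRange (xNear j) χ

  candidates : ℕ → List Raw
  candidates k = candidatesFor (row k) (col k) (phase k) (tick k)

  length-candidates : ∀ k → length (candidates k) ≡ 13 + χ * 12
  length-candidates k = cong (13 +_) (length-concatRange (xNear (col k)) (λ _ → refl) χ)

  ∈-pair : ∀ (f : ℕ → Raw) {m a b} {vs : List Raw} → m ≡ a ⊎ m ≡ b → f m ∈ f a ∷ f b ∷ vs
  ∈-pair f (inj₁ refl) = here refl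
  ∈-pair f (inj₂ refl) = there (here refl)

  listed-gadget : ∀ k {i j v} → i ≤ χ → block k ≡ gadget i j →
                  v ∈ gadgetAt i j (phase k) (tick k) → v ∈ candidates k
  listed-gadget k {i} {j} {v} i≤χ blk v∈ =
    subst₂ (λ r c → v ∈ candidatesFor r c (phase k) (tick k))
      (sym (row-of-block k i j i≤χ blk)) (sym (col-of-block k i j i≤χ blk)) (∈-++⁺ˡ v∈)

  listed-during : ∀ k {i j h v} → i ≤ χ → h < 8 → stage k ≡ stageNo i j h →
                  v ∈ sweepAt i j h (tick k) → v ∈ candidates k
  listed-during k {i} {j} {h} {v} i≤χ h<8 st v∈ =
    listed-gadget k i≤χ (block-of-stage k i j h<8 st)
      (∈-++⁺ʳ (y i j ∷ fourOf (z i j))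
        (subst (λ s → v ∈ sweepAt i j s (tick k)) (sym (phase-of-stage k i j h<8 st)) v∈))

  near-column : ∀ {j J} → j ∸ 1 ≤ J → J ≤ suc j → j ≡ J ∸ 1 ⊎ j ≡ J ⊎ j ≡ suc J
  near-column {zero}  {zero}        _  _        = inj₂ (inj₁ refl)
  near-column {zero}  {suc zero}    _  _        = inj₁ refl
  near-column {zero}  {suc (suc _)} _  (s≤s ())
  near-column {suc j} {J}           lo J≤2+j with m≤n⇒m<n∨m≡n J≤2+j
  ... | inj₂ refl   = inj₁ refl
  ... | inj₁ J<2+j with successive lo (s≤s⁻¹ J<2+j)
  ...   | inj₁ J≡j   = inj₂ (inj₂ (cong suc (sym J≡j)))
  ...   | inj₂ J≡1+j = inj₂ (inj₁ (sym J≡1+j))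

  ∈-xNear : ∀ {i j J h} → Rng h 4 → (j ≡ J ∸ 1 ⊎ j ≡ J ⊎ j ≡ suc J) → x i j h ∈ xNear J i
  ∈-xNear {i} {J = J} h∈ (inj₁ refl) = ∈-++⁺ˡ (∈-fourOf (x i (J ∸ 1)) h∈)
  ∈-xNear {i} {J = J} h∈ (inj₂ (inj₁ refl)) =
    ∈-++⁺ʳ (fourOf (x i (J ∸ 1))) (∈-++⁺ˡ (∈-fourOf (x i J) h∈))
  ∈-xNear {i} {J = J} h∈ (inj₂ (inj₂ refl)) =
    ∈-++⁺ʳ (fourOf (x i (J ∸ 1))) (∈-++⁺ʳ (fourOf (x i J)) (∈-fourOf (x i (suc J)) h∈))

  listed : ∀ k v → IsVertex v → Active k v → v ∈ candidates k
  listed k (y i j)      ((_ , i≤χ) , _) blk = listed-gadget k i≤χ blk (here refl)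
  listed k (z i j h)    (((_ , i≤χ) , _) , h∈) blk =
    listed-gadget k i≤χ blk (there (∈-++⁺ˡ (∈-fourOf (z i j) h∈)))
  listed k (x i j h)    ((i∈ , _) , h∈ , _) (lo , hi) =
    ∈-++⁺ʳ (gadgetAt (row k) (col k) (phase k) (tick k))
      (∈-concatRange (xNear (col k)) χ i∈ (∈-xNear h∈ (near-column col-lo col-hi)))
    where
    col-lo : j ∸ 1 ≤ col k
    col-lo = subst (_≤ col k) (digit-/ (j ∸ 1) (s≤s (proj₂ i∈))) (/-monoˡ-≤ N lo)
    col-hi : col k ≤ suc j
    col-hi = subst (col k ≤_) (digit-/ (suc j) (s≤s (proj₂ i∈))) (/-monoˡ-≤ N hi)
  listed k (o i j h q)  (((_ , i≤χ) , _) , h∈ , _) (st , swept) =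
    listed-during k i≤χ (rng4<8 h∈) st (∈-pair (o i j h) swept)
  listed k (u i j h λ′) (((_ , i≤χ) , _) , odd , (_ , λ≤n)) (st , lo , hi) =
    listed-during k i≤χ (odd<8 odd) st
      (there (there (∈-pair (u i j h) (predecessor-choice (level-window λ≤n lo hi)))))
  listed k (p i j m)    ((_ , i<χ) , _) (st , lo , hi) =
    listed-during k (<⇒≤ i<χ) (from-yes (5 <? 8)) st
      (there (there (there (there (∈-pair (p i j) (predecessor-choice (successive lo hi)))))))
  listed k (w i j λ′)   ((_ , i≤χ) , _) (st , lo , hi) =
    listed-during k i≤χ (from-yes (6 <? 8)) st
      (there (there (there (there (there (there (∈-pair (w i j) (predecessor-choice (successive lo hi)))))))))

  rng? : ∀ a m → Dec (Rng a m)
  rng? a m = 1 ≤? a ×-dec a ≤? m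

  grid? : ∀ i j → Dec (Grid i j)
  grid? i j = rng? i χ ×-dec rng? j χ

  isVertex? : ∀ v → Dec (IsVertex v)
  isVertex? (y i j)      = grid? i j
  isVertex? (z i j h)    = grid? i j ×-dec rng? h 4
  isVertex? (o i j h q)  = grid? i j ×-dec rng? h 4 ×-dec interior? i j q
  isVertex? (x i j h)    = grid? i j ×-dec rng? h 4 ×-dec xv i j h ≟ᵥ x i j h
  isVertex? (u i j h λ′) = grid? i j ×-dec (h ≟ 1 ⊎-dec h ≟ 3) ×-dec rng? λ′ n
  isVertex? (p i j m)    = (1 ≤? i ×-dec i <? χ) ×-dec rng? j χ ×-dec rng? m n
  isVertex? (w i j λ′)   = rng? i χ ×-dec (1 ≤? j ×-dec j <? χ) ×-dec (2 ≤? λ′ ×-dec λ′ <? n)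

  Occupies : ℕ → Raw → Set
  Occupies k v = IsVertex v × Active k v

  Meet : Raw → Raw → Set
  Meet a b = ∃ λ k → k < horizon × Occupies k a × Occupies k b

  meet-at : ∀ {i j} h l a b → Grid i j → h < 8 → l < M →
            Occupies (time i j h l) a → Occupies (time i j h l) b → Meet a b
  meet-at h l a b ((_ , i≤χ) , (_ , j≤χ)) h<8 l<M occ-a occ-b =
    _ , time<horizon i≤χ j≤χ h<8 l<M , occ-a , occ-b

  during-time : ∀ i j h {l} (P : ℕ → Set) → l < M → P l → During (stageNo i j h) P (time i j h l)
  during-time i j h P l<M Pl = stage-time i j h l<M , subst P (sym (tick-time i j h l<M)) Pl

  x-active : ∀ k i j i′ j′ {h} → gadget i′ (j′ ∸ 1) ≤ gadget i j → gadget i j ≤ gadget i′ (suc j′) →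
             block k ≡ gadget i j → Active k (x i′ j′ h)
  x-active k i j i′ j′ lo hi blk =
    subst (gadget i′ (j′ ∸ 1) ≤_) (sym blk) lo , subst (_≤ gadget i′ (suc j′)) (sym blk) hi

  own-x-active : ∀ k i j {h} → block k ≡ gadget i j → Active k (x i j h)
  own-x-active k i j {h} = x-active k i j i j {h} (gadget-monoʳ i (m∸n≤m j 1)) (gadget-monoʳ i (n≤1+n j))

  present-at : ∀ {i j} h l v → Grid i j → h < 8 → l < M → Active (time i j h l) v →
               ∃ λ k → k < horizon × Active k v
  present-at h l v ((_ , i≤χ) , (_ , j≤χ)) h<8 l<M act = _ , time<horizon i≤χ j≤χ h<8 l<M , act

  covered : ∀ v → IsVertex v → ∃ λ k → k < horizon × Active k v
  covered (y i j)      grid       = present-at 0 0 (y i j) grid z<s z<s (block-time i j z<s z<s)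
  covered (z i j h)    (grid , _) = present-at 0 0 (z i j h) grid z<s z<s (block-time i j z<s z<s)
  covered (x i j h)    (grid , _) =
    present-at 0 0 (x i j h) grid z<s z<s (own-x-active (time i j 0 0) i j {h} (block-time i j z<s z<s))
  covered (o i j h q)  (grid , h∈ , inner) =
    present-at h q (o i j h q) grid (rng4<8 h∈) q<M
      (during-time i j h (Swept (point? i j) q) q<M (inj₁ refl))
    where q<M = interior<M grid inner
  covered (u i j h λ′) (grid , odd , (_ , λ≤n)) =
    present-at h (band λ′) (u i j h λ′) grid (odd<8 odd) b<M
      (during-time i j h (Between (band λ′) (band (suc λ′))) b<M (≤-refl , <⇒≤ (band-increasing λ′)))
    where b<M = band<M (m≤n⇒m≤1+n λ≤n)
  covered (p i j m)    ((1≤i , i<χ) , j∈ , (_ , m≤n)) =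
    present-at 5 m (p i j m) ((1≤i , <⇒≤ i<χ) , j∈) (from-yes (5 <? 8)) m<M
      (during-time i j 5 (Between m (suc m)) m<M (≤-refl , n≤1+n m))
    where m<M = ≤1+n⇒<M (m≤n⇒m≤1+n m≤n)
  covered (w i j λ′)   (i∈ , (1≤j , j<χ) , (_ , λ<n)) =
    present-at 6 λ′ (w i j λ′) (i∈ , (1≤j , <⇒≤ j<χ)) (from-yes (6 <? 8)) λ<M
      (during-time i j 6 (Between λ′ (suc λ′)) λ<M (≤-refl , n≤1+n λ′))
    where λ<M = ≤1+n⇒<M (≤-trans (<⇒≤ λ<n) (n≤1+n n))

  rnext : ∀ {h} → Rng h 4 → Rng (next h) 4
  rnext {1} _ = from-yes (rng? 2 4)
  rnext {2} _ = from-yes (rng? 3 4)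
  rnext {3} _ = from-yes (rng? 4 4)
  rnext {4} _ = from-yes (rng? 1 4)
  rnext {suc (suc (suc (suc (suc _))))} (_ , s≤s (s≤s (s≤s (s≤s ()))))

  odd⇒rng : ∀ {h} → (h ≡ 1 ⊎ h ≡ 3) → Rng h 4
  odd⇒rng (inj₁ refl) = from-yes (rng? 1 4)
  odd⇒rng (inj₂ refl) = from-yes (rng? 3 4)

  interior-of : ∀ {i j q} → Pt i j q → q ≢ 0 → q ≢ L → InteriorPt i j q
  interior-of (inj₁ q≡0)         q≢0 _   = contradiction q≡0 q≢0
  interior-of (inj₂ (inj₁ q≡L))  _   q≢L = contradiction q≡L q≢L
  interior-of (inj₂ (inj₂ inner)) _  _   = inner

  segment-occupies : ∀ k {i j h q} → Grid i j → Rng h 4 → Pt i j q →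
                     During (stageNo i j h) (Swept (point? i j) q) k → Occupies k (segV i j h q)
  segment-occupies k {i} {j} {h} {q} grid h∈ pt (st , swept)
    with if²-≡ᵇ q 0 L {z i j h} {z i j (next h)} {o i j h q}
  ... | inj₁ (_ , e)            =
    subst (Occupies k) (sym e) ((grid , h∈) , block-of-stage k i j (rng4<8 h∈) st)
  ... | inj₂ (inj₁ (_ , _ , e)) =
    subst (Occupies k) (sym e) ((grid , rnext h∈) , block-of-stage k i j (rng4<8 h∈) st)
  ... | inj₂ (inj₂ (q≢0 , q≢L , e)) =
    subst (Occupies k) (sym e) ((grid , h∈ , interior-of pt q≢0 q≢L) , st , swept)

  odd-x-occupies : ∀ k i j {h} → Grid i j → (h ≡ 1 ⊎ h ≡ 3) → block k ≡ gadget i j →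
                   Occupies k (xv i j h)
  odd-x-occupies k i j grid (inj₁ refl) blk = (grid , odd⇒rng (inj₁ refl) , refl) , own-x-active k i j {1} blk
  odd-x-occupies k i j grid (inj₂ refl) blk = (grid , odd⇒rng (inj₂ refl) , refl) , own-x-active k i j {3} blk

  next-x4-occupies : ∀ k i j → Rng i χ → j < χ → block k ≡ gadget i j → Occupies k (x i (suc j) 4)
  next-x4-occupies k i j i∈ j<χ blk =
    ((i∈ , (s≤s z≤n , j<χ)) , from-yes (rng? 4 4) , refl) ,
    x-active k i j i (suc j) {4} ≤-refl (gadget-monoʳ i (m≤n⇒m≤1+n (n≤1+n j))) blk

  -- x^2_{i,j} is renamed x^4_{i,j+1} exactly when P'_{i,j} is a single vertex.
  xv2-cases : ∀ i j → (xv i j 2 ≡ x i (suc j) 4 × j < χ) ⊎ xv i j 2 ≡ x i j 2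
  xv2-cases i j with n ≡ᵇ 1 | suc j <ᵇ suc χ in j<χ
  ... | true  | true  = inj₁ (refl , s≤s⁻¹ (<ᵇ⇒< (suc j) (suc χ) (subst T (sym j<χ) tt)))
  ... | true  | false = inj₂ refl
  ... | false | _     = inj₂ refl

  x2-occupies : ∀ k i j → Grid i j → block k ≡ gadget i j → Occupies k (xv i j 2)
  x2-occupies k i j grid@(i∈ , _) blk with xv2-cases i j
  ... | inj₁ (e , j<χ) = subst (Occupies k) (sym e) (next-x4-occupies k i j i∈ j<χ blk)
  ... | inj₂ e         = subst (Occupies k) (sym e)
                           ((grid , from-yes (rng? 2 4) , e) , own-x-active k i j {2} blk)

  portal-meets : ∀ {i j h b α} → Grid i j → (h ≡ 1 ⊎ h ≡ 3) → Rng b n → Mem i j α b →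
                 Meet (u i j h b) (o i j h (dpos α b))
  portal-meets {i} {j} {h} {b} {α} grid@(i∈ , j∈) odd b∈ mem =
    meet-at h d (u i j h b) (o i j h d) grid (odd<8 odd) d<M
      ((grid , odd , b∈) , during-time i j h (Between (band b) (band (suc b))) d<M
                             (dpos-in-band b (proj₂ (proj₁ (S⊆[n]² i j α b i∈ j∈ mem)))))
      ((grid , odd⇒rng odd , inner) , during-time i j h (Swept (point? i j) d) d<M (inj₁ refl))
    where
    d     = dpos α b
    inner = α , b , mem , inj₁ refl
    d<M   = interior<M grid inner

  mark-meets : ∀ {i j h a b} v → Grid i j → Rng h 4 → Mem i j a b →
               (∀ k → block k ≡ gadget i j → Occupies k v) → Meet v (o i j h (dpos a b))
  mark-meets {i} {j} {h} {a} {b} v grid h∈ mem present =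
    meet-at h d v (o i j h d) grid (rng4<8 h∈) d<M
      (present (time i j h d) (block-time i j (rng4<8 h∈) d<M))
      ((grid , h∈ , inner) , during-time i j h (Swept (point? i j) d) d<M (inj₁ refl))
    where
    d     = dpos a b
    inner = a , b , mem , inj₁ refl
    d<M   = interior<M grid inner

  -- The edge between the k-th and (k+1)-th vertex of P_{i,j} is met at tick k+1
  -- of stage 5; its ends x^3_{i,j}, x^1_{i+1,j} stay active meanwhile.
  path-meets : ∀ {i j k} → 1 ≤ i → i < χ → Rng j χ → k ≤ n →
               Meet (pathP i j k) (pathP i j (suc k))
  path-meets {i} {j} {k} 1≤i i<χ j∈ k≤n =
    meet-at 5 (suc k) (pathP i j k) (pathP i j (suc k)) grid (from-yes (5 <? 8)) t<M start step
    where
    grid = (1≤i , <⇒≤ i<χ) , j∈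
    t    = time i j 5 (suc k)
    t<M  = ≤1+n⇒<M (s≤s k≤n)
    blk  = block-time i j (from-yes (5 <? 8)) t<M
    inner : ∀ {m} → Rng m n → Between m (suc m) (suc k) → Occupies t (p i j m)
    inner m∈ between = ((1≤i , i<χ) , j∈ , m∈) , during-time i j 5 (Between _ _) t<M between

    start : Occupies t (pathP i j k)
    start with if²-≡ᵇ k 0 (suc n) {x i j 3} {x (suc i) j 1} {p i j k}
    ... | inj₁ (_ , e)               = subst (Occupies t) (sym e)
                                         ((grid , from-yes (rng? 3 4) , refl) , own-x-active t i j {3} blk)
    ... | inj₂ (inj₁ (_ , k≡1+n , _)) = contradiction (subst (_≤ n) k≡1+n k≤n) (<-irrefl refl)
    ... | inj₂ (inj₂ (k≢0 , _ , e))  = subst (Occupies t) (sym e)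
                                         (inner (n≢0⇒n>0 k≢0 , k≤n) (n≤1+n k , ≤-refl))

    step : Occupies t (pathP i j (suc k))
    step with if²-≡ᵇ (suc k) 0 (suc n) {x i j 3} {x (suc i) j 1} {p i j (suc k)}
    ... | inj₁ (() , _)
    ... | inj₂ (inj₁ (_ , _ , e))      = subst (Occupies t) (sym e)
      ((((s≤s z≤n , i<χ) , j∈) , from-yes (rng? 1 4) , refl) ,
       x-active t i j (suc i) j {1} (gadget-next-row i (proj₁ j∈)) (gadget-diagonal i j) blk)
    ... | inj₂ (inj₂ (_ , 1+k≢1+n , e)) = subst (Occupies t) (sym e)
      (inner (s≤s z≤n , ≤∧≢⇒< k≤n (λ k≡n → 1+k≢1+n (cong suc k≡n))) (≤-refl , n≤1+n (suc k)))

  -- Likewise the edge w_λ – w_{λ+1} of P'_{i,j} is met at tick λ+1 of stage 6;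
  -- its ends x^4_{i,j+1} and x^2_{i,j} stay active meanwhile.
  path′-meets : ∀ {i j λ′} → Rng i χ → 1 ≤ j → j < χ → 1 ≤ λ′ → λ′ < n →
                Meet (pathP' i j λ′) (pathP' i j (suc λ′))
  path′-meets {i} {j} {λ′} i∈ 1≤j j<χ 1≤λ λ<n =
    meet-at 6 (suc λ′) (pathP' i j λ′) (pathP' i j (suc λ′)) grid (from-yes (6 <? 8)) t<M start step
    where
    grid = i∈ , (1≤j , <⇒≤ j<χ)
    t    = time i j 6 (suc λ′)
    t<M  = ≤1+n⇒<M (m≤n⇒m≤1+n λ<n)
    blk  = block-time i j (from-yes (6 <? 8)) t<M
    inner : ∀ {m} → 2 ≤ m → m < n → Between m (suc m) (suc λ′) → Occupies t (w i j m)
    inner 2≤m m<n between = (i∈ , (1≤j , j<χ) , (2≤m , m<n)) , during-time i j 6 (Between _ _) t<M between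

    start : Occupies t (pathP' i j λ′)
    start with if²-≡ᵇ λ′ 1 n {x i (suc j) 4} {xv i j 2} {w i j λ′}
    ... | inj₁ (_ , e)                = subst (Occupies t) (sym e) (next-x4-occupies t i j i∈ j<χ blk)
    ... | inj₂ (inj₁ (_ , λ≡n , _))    = contradiction λ≡n (<⇒≢ λ<n)
    ... | inj₂ (inj₂ (λ≢1 , _ , e))   = subst (Occupies t) (sym e)
                                          (inner (≤∧≢⇒< 1≤λ (λ≢1 ∘ sym)) λ<n (n≤1+n λ′ , ≤-refl))

    step : Occupies t (pathP' i j (suc λ′))
    step with if²-≡ᵇ (suc λ′) 1 n {x i (suc j) 4} {xv i j 2} {w i j (suc λ′)}
    ... | inj₁ (1+λ≡1 , _)            = contradiction (sym (suc-injective 1+λ≡1)) (<⇒≢ 1≤λ)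
    ... | inj₂ (inj₁ (_ , _ , e))     = subst (Occupies t) (sym e) (x2-occupies t i j grid blk)
    ... | inj₂ (inj₂ (_ , 1+λ≢n , e)) = subst (Occupies t) (sym e)
                                          (inner (s≤s 1≤λ) (≤∧≢⇒< λ<n 1+λ≢n) (≤-refl , n≤1+n (suc λ′)))

  edge-met : ∀ a b → Edge a b → Meet a b
  edge-met _ _ (yz {i} {j} {h} grid h∈) =
    meet-at 0 0 (y i j) (z i j h) grid z<s z<s (grid , blk) ((grid , h∈) , blk)
    where blk = block-time i j z<s z<s
  edge-met _ _ (seg {i} {j} {h} {q} {r} grid h∈ q-pt r-pt q<r gap) =
    meet-at h r (segV i j h q) (segV i j h r) grid (rng4<8 h∈) r<M
      (segment-occupies (time i j h r) grid h∈ q-pt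
        (during-time i j h (Swept (point? i j) q) r<M
          (inj₂ (sym (lastBelow-gap (point? i j) q-pt q<r gap)))))
      (segment-occupies (time i j h r) grid h∈ r-pt
        (during-time i j h (Swept (point? i j) r) r<M (inj₁ refl)))
    where r<M = point<M grid r-pt
  edge-met _ _ (x2v {i} {j} grid (mem , _)) =
    mark-meets (xv i j 2) grid (from-yes (rng? 2 4)) mem (λ k → x2-occupies k i j grid)
  edge-met _ _ (x4v {i} {j} grid (mem , _)) =
    mark-meets (x i j 4) grid (from-yes (rng? 4 4)) mem
      (λ k blk → (grid , from-yes (rng? 4 4) , refl) , own-x-active k i j {4} blk)
  edge-met _ _ (uu {i} {j} {h} {λ′} grid odd 1≤λ 1+λ≤n) =
    meet-at h l (u i j h λ′) (u i j h (suc λ′)) grid (odd<8 odd) l<M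
      ((grid , odd , (1≤λ , ≤-trans (n≤1+n λ′) 1+λ≤n)) ,
       during-time i j h (Between _ _) l<M (<⇒≤ (band-increasing λ′) , ≤-refl))
      ((grid , odd , (s≤s z≤n , 1+λ≤n)) ,
       during-time i j h (Between _ _) l<M (≤-refl , <⇒≤ (band-increasing (suc λ′))))
    where
    l   = band (suc λ′)
    l<M = band<M (m≤n⇒m≤1+n 1+λ≤n)
  edge-met _ _ (ux {i} {j} {h} grid odd) =
    meet-at h l (u i j h n) (xv i j h) grid (odd<8 odd) l<M
      ((grid , odd , (n≥1 , ≤-refl)) ,
       during-time i j h (Between _ _) l<M (≤-refl , <⇒≤ (band-increasing n)))
      (odd-x-occupies (time i j h l) i j grid odd (block-time i j (odd<8 odd) l<M))
    where
    l   = band n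
    l<M = band<M (n≤1+n n)
  edge-met _ _ (portal1 grid b∈ mem _) = portal-meets grid (inj₁ refl) b∈ mem
  edge-met _ _ (portal3 grid b∈ mem _) = portal-meets grid (inj₂ refl) b∈ mem
  edge-met _ _ (pP 1≤i i<χ j∈ k≤n)           = path-meets 1≤i i<χ j∈ k≤n
  edge-met _ _ (pP' i∈ 1≤j j<χ 1≤λ λ<n)      = path′-meets i∈ 1≤j j<χ 1≤λ λ<n

  schedule : Schedule IsVertex Edge
  schedule = record
    { horizon    = horizon
    ; Active     = Active
    ; active?    = active?
    ; candidates = candidates
    ; listed     = listed
    ; convex     = active-convex
    ; covered    = covered
    ; edgeMet    = edge-met
    }

  vertex⇒χ≥1 : ∀ v → IsVertex v → 1 ≤ χ
  vertex⇒χ≥1 (y _ _)     ((1≤i , i≤χ) , _)     = ≤-trans 1≤i i≤χ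
  vertex⇒χ≥1 (z _ _ _)   (((1≤i , i≤χ) , _) , _) = ≤-trans 1≤i i≤χ
  vertex⇒χ≥1 (o _ _ _ _) (((1≤i , i≤χ) , _) , _) = ≤-trans 1≤i i≤χ
  vertex⇒χ≥1 (x _ _ _)   (((1≤i , i≤χ) , _) , _) = ≤-trans 1≤i i≤χ
  vertex⇒χ≥1 (u _ _ _ _) (((1≤i , i≤χ) , _) , _) = ≤-trans 1≤i i≤χ
  vertex⇒χ≥1 (p _ _ _)   ((1≤i , i<χ) , _)     = ≤-trans 1≤i (<⇒≤ i<χ)
  vertex⇒χ≥1 (w _ _ _)   ((1≤i , i≤χ) , _)     = ≤-trans 1≤i i≤χ

  -- 13 + 12χ candidates fit into a bag of size 1 + 25χ once χ ≥ 1.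
  width-arith : ∀ c → 1 ≤ c → 13 + c * 12 ≤ suc (25 * c)
  width-arith (suc c) _ = m≤n⇒m≤1+n (subst (13 + suc c * 12 ≤_) (*-comm (suc c) 25)
                            (+-monoʳ-≤ 25 (*-monoʳ-≤ c (m≤m+n 12 13))))

  candidates-short : ∀ k v → IsVertex v → length (candidates k) ≤ suc (25 * χ)
  candidates-short k v isV =
    subst (_≤ suc (25 * χ)) (sym (length-candidates k)) (width-arith χ (vertex⇒χ≥1 v isV))

  pathwidth : PathwidthAtMost IsVertex Edge (25 * χ)
  pathwidth = schedule⇒pathwidth _≟ᵥ_ isVertex? schedule (25 * χ) candidates-short

lemma16 : ∃ λ (c : ℕ) → ∀ (I : GTInstance) →
            PathwidthAtMost (Construction.IsVertex I) (Construction.Edge I)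
                            (c * GTInstance.χ I)
lemma16 = 25 , GadgetSchedule.pathwidth
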